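{- Let $D'$ be a subdivision of a vault $D_0'$ without a niche, with walls $P_0,\dots,P_{\ell-1}$ of $D'$ (indices modulo $\ell$) as defined in the context. Then for every $i$ there is a dicycle in $D'$ avoiding $V(P_i)$, but for no $i$ is there a dicycle in $D'$ avoiding $V(P_i)\cup V(P_{i+1})$.
   Context: Vault: let $\ell\ge 5$ be odd, let $P_0,\dots,P_{\ell-1}$ be disjoint nonempty dipaths, and for each $i$ let $a_i$ be the initial and $d_i$ the terminal vertex of $P_i$, and $b_i,c_i$ vertices of $P_i$ such that either $b_ic_i$ is an arc of $P_i$ or $b_i=c_i\in\{a_i,d_i\}$. A vault is a digraph obtained from the disjoint union of the $P_i$ by adding, for every $i$ (indices mod $\ell$): (i) at least one arc from some vertex of $P_i[c_i,d_i]$ to some vertex of $P_{i+1}[a_{i+1},b_{i+1}]$ (multiple arcs allowed), and (ii) a single arc from $d_i$ to $a_{i+2}$; no further arcs. The $P_i$ are its walls. The vault has a niche if there are arcs $pq,rs$ from some $P_i$ to $P_{i+1}$ such that $p$ occurs before $r$ on $P_i$ and $q$ occurs after $s$ on $P_{i+1}$. Here $P[x,y]$ denotes the subpath of a path $P$ from $x$ to $y$ (and $P(x,y]$, $P[x,y)$ omit the respective end). A subdivision $D'$ of $D_0'$ is obtained by replacing arcs $pq$ by internally disjoint $(p,q)$-dipaths with new internal vertices; the dipath replacing $pq$ is called the link of $pq$. The wall $P_i$ of $D'$ is the dipath of $D'$ consisting of the subdivided wall $P_i$ of $D_0'$ followed by the link of the arc $d_ia_{i+2}$ with its last vertex $a_{i+2}$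 removed; $a_i$ and $d_i$ then denote the first and last vertex of this path. -}

module Defs where

open import Data.Nat using (ℕ; zero; suc; _+_; _*_; _≤_; _<_)
open import Data.Nat.DivMod using (_mod_)
open import Data.Fin using (Fin; zero; suc; toℕ; inject₁; fromℕ)
open import Data.Product using (Σ; _×_; _,_; proj₁; proj₂; ∃)
open import Data.Sum using (_⊎_)
open import Data.Empty using (⊥)
open import Relation.Nullary using (¬_)
open import Relation.Binary.PropositionalEquality using (_≡_)
open import Function.Definitions using (Injective)

Odd : ℕ → Set
Odd n = Σ ℕ λ k → n ≡ suc (2 * k)

next : ∀ {n} → Fin n → Fin n
next {suc m} i = (suc (toℕ i)) mod (suc m)

-- Wall P_i has vertices 0 … len i (so suc (len i) ≥ 1 vertices),
-- with arcs j → j+1; a_i = position 0, d_i = position len i.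
-- Forward arcs from P_i to P_{next i} are indexed by Fin (nf i)
-- (nf i ≥ 1, multiple arcs allowed); fwd i k = (p , q) is an arc from
-- position p of P_i to position q of P_{i+1}.
-- Jump arcs d_i → a_{i+2} are implicit (one per i).
record Vault : Set where
  field
    ℓ      : ℕ
    ℓ≥5    : 5 ≤ ℓ
    ℓ-odd  : Odd ℓ
    len    : Fin ℓ → ℕ
    b c    : (i : Fin ℓ) → Fin (suc (len i))
    bc-ok  : (i : Fin ℓ) →
             (toℕ (c i) ≡ suc (toℕ (b i)))
             ⊎ (b i ≡ c i × (toℕ (b i) ≡ 0 ⊎ toℕ (b i) ≡ len i))
    nf     : Fin ℓ → ℕ
    nf≥1   : (i : Fin ℓ) → 1 ≤ nf i
    fwd    : (i : Fin ℓ) → Fin (nf i) → Fin (suc (len i)) × Fin (suc (len (next i)))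
    fwd-ok : (i : Fin ℓ) (k : Fin (nf i)) →
             toℕ (c i) ≤ toℕ (proj₁ (fwd i k)) × toℕ (proj₂ (fwd i k)) ≤ toℕ (b (next i))

open Vault public

HasNiche : Vault → Set
HasNiche D = Σ (Fin (ℓ D)) λ i → Σ (Fin (nf D i)) λ k → Σ (Fin (nf D i)) λ k' →
  toℕ (proj₁ (fwd D i k)) < toℕ (proj₁ (fwd D i k'))
  × toℕ (proj₂ (fwd D i k')) < toℕ (proj₂ (fwd D i k))

-- A subdivision: number of new internal vertices on the link of each arc.
record Subdiv (D : Vault) : Set where
  field
    sW : (i : Fin (ℓ D)) → Fin (len D i) → ℕ
    sF : (i : Fin (ℓ D)) → Fin (nf D i) → ℕ
    sJ : Fin (ℓ D) → ℕ

open Subdiv public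

module _ (D : Vault) (S : Subdiv D) where

  data Vtx : Set where
    wall : (i : Fin (ℓ D)) → Fin (suc (len D i)) → Vtx
    inW  : (i : Fin (ℓ D)) (j : Fin (len D i)) → Fin (sW S i j) → Vtx
    inF  : (i : Fin (ℓ D)) (k : Fin (nf D i)) → Fin (sF S i k) → Vtx
    inJ  : (i : Fin (ℓ D)) → Fin (sJ S i) → Vtx

  LinkArc : Vtx → Vtx → (s : ℕ) → (Fin s → Vtx) → Vtx → Vtx → Set
  LinkArc u v zero    f x y = x ≡ u × y ≡ v
  LinkArc u v (suc s) f x y =
    (x ≡ u × y ≡ f zero)
    ⊎ (Σ (Fin s) λ j → x ≡ f (inject₁ j) × y ≡ f (suc j))
    ⊎ (x ≡ f (fromℕ s) × y ≡ v)

  Arc : Vtx → Vtx → Set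
  Arc x y =
    (Σ (Fin (ℓ D)) λ i → Σ (Fin (len D i)) λ j →
       LinkArc (wall i (inject₁ j)) (wall i (suc j)) (sW S i j) (inW i j) x y)
    ⊎ (Σ (Fin (ℓ D)) λ i → Σ (Fin (nf D i)) λ k →
       LinkArc (wall i (proj₁ (fwd D i k))) (wall (next i) (proj₂ (fwd D i k)))
               (sF S i k) (inF i k) x y)
    ⊎ (Σ (Fin (ℓ D)) λ i →
       LinkArc (wall i (fromℕ (len D i))) (wall (next (next i)) zero) (sJ S i) (inJ i) x y)

  record Dicycle : Set where
    field
      k     : ℕ
      vs    : Fin (suc k) → Vtx
      inj   : Injective _≡_ _≡_ vs
      step  : (j : Fin k) → Arc (vs (inject₁ j)) (vs (suc j))
      close : Arc (vs (fromℕ k)) (vs zero)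

  Avoids : Dicycle → (Vtx → Set) → Set
  Avoids C X = (j : Fin (suc (Dicycle.k C))) → ¬ X (Dicycle.vs C j)

  -- V(P_i) for the wall P_i of D': subdivided wall P_i together with the
  -- internal vertices of the link of d_i a_{i+2}
  InWall : Fin (ℓ D) → Vtx → Set
  InWall i (wall i' _)  = i' ≡ i
  InWall i (inW i' _ _) = i' ≡ i
  InWall i (inF _ _ _)  = ⊥
  InWall i (inJ i' _)   = i' ≡ i

-- Fix i and rank the walls cyclically starting from P_{i+1}. Order the vertices of D'
-- lexicographically by (rank of their wall, position along the wall, position inside a link),
-- the internal vertices of the link of an arc P_j → P_{j+1} counting as part of P_{j+1}.
-- Every arc of D' whose ends avoid P_i climbs in this order unless it ends at a_{i+1}: wall arcs
-- move forward along a wall, forward arcs climb one rank and jump arcs two ranks, the only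
-- exception being the jump d_{i-1} a_{i+1}. Hence every dicycle avoiding P_i passes through
-- a_{i+1} ∈ P_{i+1}, which is the second claim. For the first, walk from a_{i+1} along the walls,
-- taking the jump arc at the end of each wall, except that P_{i-2} is left along its first
-- forward arc to P_{i-1}. This walk avoids P_i and climbs until it is back at a_{i+1}, and since
-- the order is bounded it does come back, closing a dicycle.

module Submission where

open import Defs
open import Data.Fin using (Fin; zero; suc; toℕ; inject₁; fromℕ; fromℕ<)
open import Data.Fin.Properties
  using (toℕ-injective; toℕ-inject₁; toℕ-fromℕ; toℕ-fromℕ<; toℕ<n; ≤fromℕ; ≤̄⇒inject₁<)
  renaming (_≟_ to _≟ᶠ_)
open import Data.Fin.Relation.Unary.Top using (View; view; ‵fromℕ; ‵inject₁)
open import Data.List using (tabulate)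
open import Data.List.Extrema.Nat using (max; xs≤max)
open import Data.List.Relation.Unary.All.Properties using (tabulate⁻)
open import Data.Nat
open import Data.Nat.DivMod using (m<n⇒m%n≡m; n%n≡0)
open import Data.Nat.Properties
open import Data.Product using (Σ; _×_; _,_; proj₁; proj₂)
open import Data.Sum using (_⊎_; inj₁; inj₂)
open import Function using (_∘_)
open import Relation.Binary.Definitions using (tri<; tri≈; tri>)
open import Relation.Nullary using (¬_; Dec; yes; no; _×-dec_; contradiction)
open import Relation.Binary.PropositionalEquality

toℕ-next : ∀ {n} (j : Fin n) →
  (suc (toℕ j) < n × toℕ (next j) ≡ suc (toℕ j)) ⊎ (suc (toℕ j) ≡ n × toℕ (next j) ≡ 0)
toℕ-next {suc m} j with m≤n⇒m<n∨m≡n (toℕ<n j)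
... | inj₁ j+1<n = inj₁ (j+1<n , trans (toℕ-fromℕ< _) (m<n⇒m%n≡m j+1<n))
... | inj₂ j+1≡n =
  inj₂ (j+1≡n , trans (toℕ-fromℕ< _) (trans (cong (_% suc m) j+1≡n) (n%n≡0 (suc m))))

next-injective : ∀ {n} {j j′ : Fin n} → next j ≡ next j′ → j ≡ j′
next-injective {j = j} {j′} e with toℕ-next j | toℕ-next j′
... | inj₁ (_ , p) | inj₁ (_ , q) = toℕ-injective (suc-injective (trans (sym p) (trans (cong toℕ e) q)))
... | inj₁ (_ , p) | inj₂ (_ , q) = contradiction (trans (sym p) (trans (cong toℕ e) q)) 1+n≢0
... | inj₂ (_ , p) | inj₁ (_ , q) = contradiction (trans (sym q) (trans (cong toℕ (sym e)) p)) 1+n≢0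
... | inj₂ (p , _) | inj₂ (q , _) = toℕ-injective (suc-injective (trans p (sym q)))

next-≢ : ∀ {n} → 2 ≤ n → (j : Fin n) → next j ≢ j
next-≢ {n} 2≤n j e with toℕ-next j
... | inj₁ (_ , p) = 1+n≢n (trans (sym p) (cong toℕ e))
... | inj₂ (j+1≡n , p) = contradiction (subst (2 ≤_) n≡1 2≤n) λ { (s≤s ()) }
  where
    n≡1 : n ≡ 1
    n≡1 = trans (sym j+1≡n) (cong suc (trans (sym (cong toℕ e)) p))

3≤n⇒n≢2 : ∀ {n} → 3 ≤ n → n ≢ 2
3≤n⇒n≢2 (s≤s (s≤s ())) refl

next²-≢ : ∀ {n} → 3 ≤ n → (j : Fin n) → next (next j) ≢ j
next²-≢ 3≤n j e with toℕ-next j | toℕ-next (next j)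
... | inj₁ (_ , p) | inj₁ (_ , q) =
  <⇒≢ (m<n⇒m<1+n (n<1+n _)) (trans (sym (cong toℕ e)) (trans q (cong suc p)))
... | inj₁ (_ , p) | inj₂ (q , r) = 3≤n⇒n≢2 3≤n (trans (sym q) (cong suc (trans p (cong suc j≡0))))
  where
    j≡0 : toℕ j ≡ 0
    j≡0 = trans (sym (cong toℕ e)) r
... | inj₂ (p , p′) | inj₁ (_ , q) = 3≤n⇒n≢2 3≤n (trans (sym p) (cong suc j≡1))
  where
    j≡1 : toℕ j ≡ 1
    j≡1 = trans (sym (cong toℕ e)) (trans q (cong suc p′))
... | inj₂ (_ , p) | inj₂ (q , _) with trans (sym q) (cong suc p)
next²-≢ (s≤s ()) j e | inj₂ _ | inj₂ _ | refl

module Rank {n : ℕ} (i : Fin n) where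
  open ≡-Reasoning

  rank : Fin n → ℕ
  rank j with toℕ i <? toℕ j
  ... | yes _ = toℕ j
  ... | no  _ = n + toℕ j

  rank-above : ∀ {j} → toℕ i < toℕ j → rank j ≡ toℕ j
  rank-above {j} i<j with toℕ i <? toℕ j
  ... | yes _   = refl
  ... | no  i≮j = contradiction i<j i≮j

  rank-below : ∀ {j} → toℕ j ≤ toℕ i → rank j ≡ n + toℕ j
  rank-below {j} j≤i with toℕ i <? toℕ j
  ... | yes i<j = contradiction j≤i (<⇒≱ i<j)
  ... | no  _   = refl

  rank-< : ∀ j → rank j < n + n
  rank-< j with toℕ i <? toℕ j
  ... | yes _ = ≤-trans (toℕ<n j) (m≤m+n n n)
  ... | no  _ = +-monoʳ-< n (toℕ<n j)

  rank-next : ∀ {j} → j ≢ i → rank (next j) ≡ suc (rank j)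
  rank-next {j} j≢i with toℕ-next j | ≤-<-connex (toℕ j) (toℕ i)
  ... | inj₁ (_ , p) | inj₂ i<j = begin
    rank (next j) ≡⟨ rank-above (subst (toℕ i <_) (sym p) (m<n⇒m<1+n i<j)) ⟩
    toℕ (next j)  ≡⟨ p ⟩
    suc (toℕ j)   ≡⟨ cong suc (rank-above i<j) ⟨
    suc (rank j)  ∎
  ... | inj₁ (_ , p) | inj₁ j≤i = begin
    rank (next j)      ≡⟨ rank-below (subst (_≤ toℕ i) (sym p) j<i) ⟩
    n + toℕ (next j)   ≡⟨ cong (n +_) p ⟩
    n + suc (toℕ j)    ≡⟨ +-suc n (toℕ j) ⟩
    suc (n + toℕ j)    ≡⟨ cong suc (rank-below (<⇒≤ j<i)) ⟨
    suc (rank j)       ∎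
    where
      j<i : toℕ j < toℕ i
      j<i = ≤∧≢⇒< j≤i (j≢i ∘ toℕ-injective)
  ... | inj₂ (j+1≡n , p) | inj₂ i<j = begin
    rank (next j)      ≡⟨ rank-below (subst (_≤ toℕ i) (sym p) z≤n) ⟩
    n + toℕ (next j)   ≡⟨ cong (n +_) p ⟩
    n + 0              ≡⟨ +-identityʳ n ⟩
    n                  ≡⟨ j+1≡n ⟨
    suc (toℕ j)        ≡⟨ cong suc (rank-above i<j) ⟨
    suc (rank j)       ∎
  ... | inj₂ (j+1≡n , _) | inj₁ j≤i =
    contradiction (toℕ-injective (≤-antisym j≤i (s≤s⁻¹ (subst (toℕ i <_) (sym j+1≡n) (toℕ<n i))))) j≢i

  rank-<-next : ∀ {j} → j ≢ i → rank j < rank (next j)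
  rank-<-next j≢i = ≤-reflexive (sym (rank-next j≢i))

  rank-<-next² : ∀ {j} → j ≢ i → next j ≢ i → rank j < rank (next (next j))
  rank-<-next² j≢i j+1≢i = <-trans (rank-<-next j≢i) (rank-<-next j+1≢i)

radix : ℕ → ℕ → ℕ → ℕ → ℕ
radix M r a b = (r * M + a) * M + b

*+-lex-< : ∀ {M x x′ b} b′ → x < x′ → b < M → x * M + b < x′ * M + b′
*+-lex-< {M} {x} {x′} {b} b′ x<x′ b<M = begin-strict
  x * M + b   <⟨ +-monoʳ-< (x * M) b<M ⟩
  x * M + M   ≡⟨ +-comm (x * M) M ⟩
  suc x * M   ≤⟨ *-monoˡ-≤ M x<x′ ⟩
  x′ * M      ≤⟨ m≤m+n (x′ * M) b′ ⟩
  x′ * M + b′ ∎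
  where open ≤-Reasoning

radix-<₁ : ∀ {M r r′ a b} a′ b′ → r < r′ → a < M → b < M → radix M r a b < radix M r′ a′ b′
radix-<₁ a′ b′ r<r′ a<M b<M = *+-lex-< b′ (*+-lex-< a′ r<r′ a<M) b<M

radix-<₂ : ∀ {M r a a′ b} b′ → a < a′ → b < M → radix M r a b < radix M r a′ b′
radix-<₂ {r = r} b′ a<a′ b<M = *+-lex-< b′ (+-monoʳ-< (r * _) a<a′) b<M

radix-<₃ : ∀ {M r a b b′} → b < b′ → radix M r a b < radix M r a b′
radix-<₃ = +-monoʳ-< _

sup : ∀ {m} → (Fin m → ℕ) → ℕ
sup f = max 0 (tabulate f)

≤-sup : ∀ {m} (f : Fin m → ℕ) j → f j ≤ sup f
≤-sup f = tabulate⁻ (xs≤max 0 (tabulate f))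

increasing⇒first≤last : ∀ k (f : Fin (suc k) → ℕ) →
  (∀ j → f (inject₁ j) < f (suc j)) → f zero ≤ f (fromℕ k)
increasing⇒first≤last zero    f f↑ = ≤-refl
increasing⇒first≤last (suc k) f f↑ =
  ≤-trans (increasing⇒first≤last k (f ∘ inject₁) (f↑ ∘ inject₁)) (<⇒≤ (f↑ (fromℕ k)))

module _ {D : Vault} {S : Subdiv D} where

  wall-injectiveˡ : ∀ {j j′ p p′} → wall {D} {S} j p ≡ wall j′ p′ → j ≡ j′
  wall-injectiveˡ refl = refl

  data LinkStep (u v : Vtx D S) {s} (f : Fin s → Vtx D S) : Vtx D S → Vtx D S → Set where
    direct : LinkStep u v f u v
    enter  : ∀ z → LinkStep u v f u (f z)
    inside : ∀ {z z′} → toℕ z < toℕ z′ → LinkStep u v f (f z) (f z′)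
    leave  : ∀ z → LinkStep u v f (f z) v

  linkStep : ∀ {u v x y} s {f} → LinkArc D S u v s f x y → LinkStep u v f x y
  linkStep zero    (refl , refl)                = direct
  linkStep (suc s) (inj₁ (refl , refl))         = enter zero
  linkStep (suc s) (inj₂ (inj₁ (j , refl , refl))) = inside (≤̄⇒inject₁< ≤-refl)
  linkStep (suc s) (inj₂ (inj₂ (refl , refl)))  = leave (fromℕ s)

  linkStart : ∀ {s} → (Fin s → Vtx D S) → Vtx D S → Vtx D S
  linkStart {zero}  f v = v
  linkStart {suc s} f v = f zero

  linkNext : ∀ {s} → (Fin s → Vtx D S) → Vtx D S → Fin s → Vtx D S
  linkNext {suc s} f v m with view m
  ... | ‵fromℕ     = v
  ... | ‵inject₁ t = f (suc t)

  linkStart-arc : ∀ {u v s} (f : Fin s → Vtx D S) → LinkArc D S u v s f u (linkStart f v)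
  linkStart-arc {s = zero}  f = refl , refl
  linkStart-arc {s = suc s} f = inj₁ (refl , refl)

  linkNext-arc : ∀ {u v s} (f : Fin s → Vtx D S) m → LinkArc D S u v s f (f m) (linkNext f v m)
  linkNext-arc {s = suc s} f m with view m
  ... | ‵fromℕ     = inj₂ (inj₂ (refl , refl))
  ... | ‵inject₁ t = inj₂ (inj₁ (t , refl , refl))

  linkStart-elim : ∀ (P : Vtx D S → Set) {s} (f : Fin s → Vtx D S) v →
    P v → (∀ z → P (f z)) → P (linkStart f v)
  linkStart-elim P {zero}  f v Pv Pf = Pv
  linkStart-elim P {suc s} f v Pv Pf = Pf zero

  linkNext-elim : ∀ (P : Vtx D S → Set) {s} (f : Fin s → Vtx D S) v m →
    P v → (∀ z → P (f z)) → P (linkNext f v m)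
  linkNext-elim P {suc s} f v m Pv Pf with view m
  ... | ‵fromℕ     = Pv
  ... | ‵inject₁ t = Pf (suc t)

  no-dicycle-avoiding : ∀ {Y : Vtx D S → Set} (Φ : Vtx D S → ℕ) →
    (∀ {x y} → Arc D S x y → ¬ Y x → ¬ Y y → Φ x < Φ y) →
    (C : Dicycle D S) → ¬ Avoids D S C Y
  no-dicycle-avoiding Φ Φ↑ C avoids =
    <⇒≱ (Φ↑ close (avoids (fromℕ k)) (avoids zero))
        (increasing⇒first≤last k (Φ ∘ vs) λ j → Φ↑ (step j) (avoids (inject₁ j)) (avoids (suc j)))
    where open Dicycle C

module ClimbingWalk {D : Vault} {S : Subdiv D}
  (Good : Vtx D S → Set) (Φ : Vtx D S → ℕ) {B : ℕ} (Φ<B : ∀ x → Φ x < B)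
  (step : Vtx D S → Vtx D S) (a : Vtx D S) (good-a : Good a)
  (step-ok : ∀ x → Good x → Arc D S x (step x) × (step x ≡ a ⊎ (Good (step x) × Φ x < Φ (step x))))
  where

  walk : ℕ → Vtx D S
  walk zero    = a
  walk (suc t) = step (walk t)

  Ascends : ℕ → Set
  Ascends K = ∀ t → t < K → Good (walk t) × Φ (walk t) < Φ (walk (suc t))

  ascends-suc : ∀ {K} → Ascends K → Good (walk K) → Φ (walk K) < Φ (walk (suc K)) → Ascends (suc K)
  ascends-suc asc g Φ↑ t t<1+K with m≤n⇒m<n∨m≡n (s≤s⁻¹ t<1+K)
  ... | inj₁ t<K = asc t t<K
  ... | inj₂ refl = g , Φ↑

  ascends-< : ∀ {K t t′} → Ascends K → t < t′ → t′ ≤ K → Φ (walk t) < Φ (walk t′)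
  ascends-< {t′ = suc t′} asc t<1+t′ 1+t′≤K with m≤n⇒m<n∨m≡n (s≤s⁻¹ t<1+t′)
  ... | inj₁ t<t′ = <-trans (ascends-< asc t<t′ (<⇒≤ 1+t′≤K)) (proj₂ (asc t′ 1+t′≤K))
  ... | inj₂ refl = proj₂ (asc t′ 1+t′≤K)

  -- Φ climbs at every step and stays below B, so B steps of fuel suffice.
  returns : Σ ℕ λ K → Ascends K × Good (walk K) × walk (suc K) ≡ a
  returns = search B 0 (m≤m+n B _) (λ _ ()) good-a
    where
      search : ∀ fuel m → B ≤ fuel + Φ (walk m) → Ascends m → Good (walk m) →
        Σ ℕ λ K → Ascends K × Good (walk K) × walk (suc K) ≡ a
      search zero m B≤Φ _ _ = contradiction B≤Φ (<⇒≱ (Φ<B (walk m)))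
      search (suc fuel) m B≤ asc g with step-ok (walk m) g
      ... | _ , inj₁ back     = m , asc , g , back
      ... | _ , inj₂ (g′ , Φ↑) = search fuel (suc m)
        (≤-trans B≤ (≤-trans (≤-reflexive (sym (+-suc fuel _))) (+-monoʳ-≤ fuel Φ↑)))
        (ascends-suc asc g Φ↑) g′

  dicycle : Σ (Dicycle D S) λ C → ∀ j → Good (Dicycle.vs C j)
  dicycle with returns
  ... | K , asc , good-K , back =
    record { k = K ; vs = vs ; inj = injective ; step = arc ; close = closing } , good
    where
      vs : Fin (suc K) → Vtx D S
      vs j = walk (toℕ j)

      good : ∀ j → Good (vs j)
      good j with m≤n⇒m<n∨m≡n (s≤s⁻¹ (toℕ<n j))
      ... | inj₁ j<K = proj₁ (asc (toℕ j) j<K)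
      ... | inj₂ j≡K = subst (Good ∘ walk) (sym j≡K) good-K

      injective : ∀ {j j′} → vs j ≡ vs j′ → j ≡ j′
      injective {j} {j′} e with <-cmp (toℕ j) (toℕ j′)
      ... | tri< j<j′ _ _ = contradiction (cong Φ e) (<⇒≢ (ascends-< asc j<j′ (s≤s⁻¹ (toℕ<n j′))))
      ... | tri≈ _ j≡j′ _ = toℕ-injective j≡j′
      ... | tri> _ _ j′<j = contradiction (cong Φ (sym e)) (<⇒≢ (ascends-< asc j′<j (s≤s⁻¹ (toℕ<n j))))

      arc : (j : Fin K) → Arc D S (vs (inject₁ j)) (vs (suc j))
      arc j rewrite toℕ-inject₁ j = proj₁ (step-ok _ (proj₁ (asc (toℕ j) (toℕ<n j))))

      closing : Arc D S (vs (fromℕ K)) (vs zero)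
      closing rewrite toℕ-fromℕ K = subst (Arc D S (walk K)) back (proj₁ (step-ok _ good-K))

module Potential (D : Vault) (S : Subdiv D) (i : Fin (ℓ D)) where
  open Rank i

  a₀ : Vtx D S
  a₀ = wall (next i) zero

  room : Fin (ℓ D) → ℕ
  room j = len D j + sJ S j + sup (sW S j) + sup (sF S j)

  M : ℕ
  M = 3 + sup room

  ≤2+room⇒<M : ∀ {x} j → x ≤ 2 + room j → x < M
  ≤2+room⇒<M j x≤ = s≤s (≤-trans x≤ (+-monoʳ-≤ 2 (≤-sup room j)))

  ≤room⇒<M : ∀ {x} j → x ≤ room j → x < M
  ≤room⇒<M j x≤ = ≤2+room⇒<M j (≤-trans x≤ (m≤n+m (room j) 2))

  len≤room : ∀ j → len D j ≤ room j
  len≤room j = ≤-trans (m≤m+n (len D j) (sJ S j))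
    (≤-trans (m≤m+n _ (sup (sW S j))) (m≤m+n _ (sup (sF S j))))

  sJ≤room : ∀ j → sJ S j ≤ room j
  sJ≤room j = ≤-trans (m≤n+m (sJ S j) (len D j))
    (≤-trans (m≤m+n _ (sup (sW S j))) (m≤m+n _ (sup (sF S j))))

  sW≤room : ∀ j t → sW S j t ≤ room j
  sW≤room j t = ≤-trans (≤-sup (sW S j) t)
    (≤-trans (m≤n+m _ (len D j + sJ S j)) (m≤m+n _ (sup (sF S j))))

  sF≤room : ∀ j k → sF S j k ≤ room j
  sF≤room j k = ≤-trans (≤-sup (sF S j) k) (m≤n+m _ (len D j + sJ S j + sup (sW S j)))

  block pos sub : Vtx D S → ℕ
  block (wall j _)   = rank j
  block (inW j _ _)  = rank j
  block (inF j _ _)  = rank (next j)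
  block (inJ j _)    = rank j
  pos (wall _ p)     = suc (toℕ p)
  pos (inW _ t _)    = suc (toℕ t)
  pos (inF _ _ _)    = 0
  pos (inJ j _)      = 2 + len D j
  sub (wall _ _)     = 0
  sub (inW _ _ m)    = suc (toℕ m)
  sub (inF _ _ m)    = toℕ m
  sub (inJ _ m)      = toℕ m

  pos<M : ∀ v → pos v < M
  pos<M (wall j p)  = ≤2+room⇒<M j (≤-trans (toℕ<n p) (m≤n⇒m≤1+n (s≤s (len≤room j))))
  pos<M (inW j t _) = ≤room⇒<M j (≤-trans (toℕ<n t) (len≤room j))
  pos<M (inF _ _ _) = s≤s z≤n
  pos<M (inJ j _)   = ≤2+room⇒<M j (s≤s (s≤s (len≤room j)))

  sub<M : ∀ v → sub v < M
  sub<M (wall _ _)  = s≤s z≤n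
  sub<M (inW j t m) = ≤room⇒<M j (≤-trans (toℕ<n m) (sW≤room j t))
  sub<M (inF j k m) = ≤room⇒<M j (≤-trans (<⇒≤ (toℕ<n m)) (sF≤room j k))
  sub<M (inJ j m)   = ≤room⇒<M j (≤-trans (<⇒≤ (toℕ<n m)) (sJ≤room j))

  -- Opaque, so that a goal Φ x < Φ y determines x and y.
  opaque
    Φ : Vtx D S → ℕ
    Φ v = radix M (block v) (pos v) (sub v)

  opaque
    unfolding Φ

    Φ<B : ∀ v → Φ v < radix M (ℓ D + ℓ D) 0 0
    Φ<B v = radix-<₁ 0 0 (block<2ℓ v) (pos<M v) (sub<M v)
      where
        block<2ℓ : ∀ v → block v < ℓ D + ℓ D
        block<2ℓ (wall j _)  = rank-< j
        block<2ℓ (inW j _ _) = rank-< j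
        block<2ℓ (inF j _ _) = rank-< (next j)
        block<2ℓ (inJ j _)   = rank-< j

    Φ-<-block : ∀ {x y} → block x < block y → Φ x < Φ y
    Φ-<-block {x} lt = radix-<₁ _ _ lt (pos<M x) (sub<M x)

    Φ-<-pos : ∀ {x y} → block x ≡ block y → pos x < pos y → Φ x < Φ y
    Φ-<-pos {x} {y} e lt =
      subst (λ r → Φ x < radix M r (pos y) (sub y)) e (radix-<₂ {M} {block x} (sub y) lt (sub<M x))

    Φ-<-sub : ∀ {x y} → block x ≡ block y → pos x ≡ pos y → sub x < sub y → Φ x < Φ y
    Φ-<-sub {x} {y} e e′ lt =
      subst₂ (λ r a → Φ x < radix M r a (sub y)) e e′ (radix-<₃ {M} {block x} {pos x} lt)

  jump-climbs : ∀ {j} → j ≢ i → wall (next (next j)) zero ≢ a₀ → rank j < rank (next (next j))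
  jump-climbs j≢i ≢a₀ = rank-<-next² j≢i λ e → ≢a₀ (cong (λ z → wall (next z) zero) e)

  Φ-increasing : ∀ {x y} → Arc D S x y → ¬ InWall D S i x → ¬ InWall D S i y → y ≢ a₀ → Φ x < Φ y
  Φ-increasing (inj₁ (j , t , arc)) _ _ _ with linkStep (sW S j t) arc
  ... | direct   = Φ-<-pos refl (s≤s (≤̄⇒inject₁< ≤-refl))
  ... | enter _  = Φ-<-sub refl (cong suc (toℕ-inject₁ t)) (s≤s z≤n)
  ... | inside z<z′ = Φ-<-sub refl refl (s≤s z<z′)
  ... | leave _  = Φ-<-pos refl (n<1+n _)
  Φ-increasing (inj₂ (inj₁ (j , k , arc))) j≢i _ _ with linkStep (sF S j k) arc
  ... | direct   = Φ-<-block (rank-<-next j≢i)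
  ... | enter _  = Φ-<-block (rank-<-next j≢i)
  ... | inside z<z′ = Φ-<-sub refl refl z<z′
  ... | leave _  = Φ-<-pos refl (s≤s z≤n)
  Φ-increasing (inj₂ (inj₂ (j , arc))) j≢i _ y≢a₀ with linkStep (sJ S j) arc
  ... | direct   = Φ-<-block (jump-climbs j≢i y≢a₀)
  ... | enter _  = Φ-<-pos refl (s≤s (s≤s (≤-reflexive (toℕ-fromℕ _))))
  ... | inside z<z′ = Φ-<-sub refl refl z<z′
  ... | leave _  = Φ-<-block (jump-climbs j≢i y≢a₀)

  no-dicycle-avoiding-two-walls :
    ¬ (Σ (Dicycle D S) λ C → Avoids D S C (λ v → InWall D S i v ⊎ InWall D S (next i) v))
  no-dicycle-avoiding-two-walls (C , avoids) = no-dicycle-avoiding Φ Φ↑ C avoids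
    where
      Φ↑ : ∀ {x y} → Arc D S x y →
        ¬ (InWall D S i x ⊎ InWall D S (next i) x) →
        ¬ (InWall D S i y ⊎ InWall D S (next i) y) → Φ x < Φ y
      Φ↑ arc x∉ y∉ = Φ-increasing arc (x∉ ∘ inj₁) (y∉ ∘ inj₁) λ { refl → y∉ (inj₂ refl) }

module AvoidingWalk (D : Vault) (S : Subdiv D) (i : Fin (ℓ D)) where
  open Potential D S i

  2≤ℓ : 2 ≤ ℓ D
  2≤ℓ = ≤-trans (s≤s (s≤s z≤n)) (ℓ≥5 D)

  3≤ℓ : 3 ≤ ℓ D
  3≤ℓ = ≤-trans (s≤s (s≤s (s≤s z≤n))) (ℓ≥5 D)

  exitArc : (j : Fin (ℓ D)) → Fin (nf D j)
  exitArc j = fromℕ< (nf≥1 D j)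

  exit : (j : Fin (ℓ D)) → Fin (suc (len D j))
  exit j = proj₁ (fwd D j (exitArc j))

  entry : (j : Fin (ℓ D)) → Fin (suc (len D (next j)))
  entry j = proj₂ (fwd D j (exitArc j))

  Good : Vtx D S → Set
  Good (wall j p)  = j ≢ i × (next (next j) ≡ i → toℕ p ≤ toℕ (exit j))
  Good (inW j t _) = j ≢ i × (next (next j) ≡ i → toℕ t < toℕ (exit j))
  Good (inF j _ _) = next (next j) ≡ i
  Good (inJ j _)   = j ≢ i × next (next j) ≢ i

  good-a₀ : Good a₀
  good-a₀ = next-≢ 2≤ℓ i , λ _ → z≤n

  good-avoids : ∀ x → Good x → ¬ InWall D S i x
  good-avoids (wall _ _)  (j≢i , _) = j≢i
  good-avoids (inW _ _ _) (j≢i , _) = j≢i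
  good-avoids (inF _ _ _) _ ()
  good-avoids (inJ _ _)   (j≢i , _) = j≢i

  leaveWall : ∀ j p → Dec (next (next j) ≡ i × p ≡ exit j) → View p → Vtx D S
  leaveWall j p (yes _) _ = linkStart (inF j (exitArc j)) (wall (next j) (entry j))
  leaveWall j _ (no _) ‵fromℕ       = linkStart (inJ j) (wall (next (next j)) zero)
  leaveWall j _ (no _) (‵inject₁ t) = linkStart (inW j t) (wall j (suc t))

  step : Vtx D S → Vtx D S
  step (wall j p)  = leaveWall j p (next (next j) ≟ᶠ i ×-dec p ≟ᶠ exit j) (view p)
  step (inW j t m) = linkNext (inW j t) (wall j (suc t)) m
  step (inF j k m) = linkNext (inF j k) (wall (next j) (proj₂ (fwd D j k))) m
  step (inJ j m)   = linkNext (inJ j) (wall (next (next j)) zero) m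

  Continues : Vtx D S → Set
  Continues y = y ≡ a₀ ⊎ (Good y × y ≢ a₀)

  forward-landing : ∀ j → next (next j) ≡ i → ∀ q → Continues (wall (next j) q)
  forward-landing j exits q =
    inj₂ ((j+1≢i , λ e → contradiction (trans (cong next (sym exits)) e) i+1≢i) , ≢a₀)
    where
      i+1≢i : next i ≢ i
      i+1≢i = next-≢ 2≤ℓ i
      j+1≢i : next j ≢ i
      j+1≢i e = i+1≢i (trans (cong next (sym e)) exits)
      ≢a₀ : wall (next j) q ≢ a₀
      ≢a₀ e = next²-≢ 3≤ℓ i (subst (λ z → next (next z) ≡ i) (next-injective (wall-injectiveˡ e)) exits)

  jump-landing : ∀ j → next (next j) ≢ i → Continues (wall (next (next j)) zero)
  jump-landing j ¬exits with next j ≟ᶠ i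
  ... | yes j+1≡i = inj₁ (cong (λ z → wall (next z) zero) j+1≡i)
  ... | no  j+1≢i = inj₂ ((¬exits , λ _ → z≤n) , λ e → j+1≢i (next-injective (wall-injectiveˡ e)))

  leaveWall-ok : ∀ j p d (v : View p) → Good (wall j p) →
    Arc D S (wall j p) (leaveWall j p d v) × Continues (leaveWall j p d v)
  leaveWall-ok j _ (yes (exits , refl)) _ _ =
    inj₂ (inj₁ (j , exitArc j , linkStart-arc _)) ,
    linkStart-elim Continues (inF j (exitArc j)) (wall (next j) (entry j))
      (forward-landing j exits _) (λ _ → inj₂ (exits , λ ()))
  leaveWall-ok j _ (no ¬exit) ‵fromℕ (j≢i , ≤exit) =
    inj₂ (inj₂ (j , linkStart-arc _)) ,
    linkStart-elim Continues (inJ j) (wall (next (next j)) zero)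
      (jump-landing j ¬exits) (λ _ → inj₂ ((j≢i , ¬exits) , λ ()))
    where
      ¬exits : next (next j) ≢ i
      ¬exits e = ¬exit (e , toℕ-injective (≤-antisym (≤exit e) (≤fromℕ (exit j))))
  leaveWall-ok j _ (no ¬exit) (‵inject₁ t) (j≢i , ≤exit) =
    inj₁ (j , t , linkStart-arc _) ,
    linkStart-elim Continues (inW j t) (wall j (suc t)) (inj₂ (good , λ ())) (λ _ → inj₂ (good , λ ()))
    where
      good : j ≢ i × (next (next j) ≡ i → toℕ t < toℕ (exit j))
      good = j≢i , λ e → subst (_< toℕ (exit j)) (toℕ-inject₁ t)
                           (≤∧≢⇒< (≤exit e) (λ e′ → ¬exit (e , toℕ-injective e′)))

  step-ok : ∀ x → Good x → Arc D S x (step x) × Continues (step x)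
  step-ok (wall j p) = leaveWall-ok j p (next (next j) ≟ᶠ i ×-dec p ≟ᶠ exit j) (view p)
  step-ok (inW j t m) g =
    inj₁ (j , t , linkNext-arc _ m) ,
    linkNext-elim Continues (inW j t) (wall j (suc t)) m (inj₂ (g , λ ())) (λ _ → inj₂ (g , λ ()))
  step-ok (inF j k m) exits =
    inj₂ (inj₁ (j , k , linkNext-arc _ m)) ,
    linkNext-elim Continues (inF j k) (wall (next j) (proj₂ (fwd D j k))) m
      (forward-landing j exits _) (λ _ → inj₂ (exits , λ ()))
  step-ok (inJ j m) g =
    inj₂ (inj₂ (j , linkNext-arc _ m)) ,
    linkNext-elim Continues (inJ j) (wall (next (next j)) zero) m
      (jump-landing j (proj₂ g)) (λ _ → inj₂ (g , λ ()))

  step-climbs : ∀ x → Good x → Arc D S x (step x) × (step x ≡ a₀ ⊎ (Good (step x) × Φ x < Φ (step x)))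
  step-climbs x g with step-ok x g
  ... | arc , inj₁ back = arc , inj₁ back
  ... | arc , inj₂ (g′ , ≢a₀) =
    arc , inj₂ (g′ , Φ-increasing arc (good-avoids x g) (good-avoids _ g′) ≢a₀)

  dicycle-avoiding-wall : Σ (Dicycle D S) λ C → Avoids D S C (InWall D S i)
  dicycle-avoiding-wall with ClimbingWalk.dicycle Good Φ Φ<B step a₀ good-a₀ step-climbs
  ... | C , good = C , λ j → good-avoids _ (good j)

lemma3 : (D : Vault) (S : Subdiv D) → ¬ HasNiche D →
    ((i : Fin (ℓ D)) → Σ (Dicycle D S) λ C → Avoids D S C (InWall D S i))
    × ((i : Fin (ℓ D)) → ¬ (Σ (Dicycle D S) λ C →
         Avoids D S C (λ v → InWall D S i v ⊎ InWall D S (next i) v)))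
lemma3 D S _ = AvoidingWalk.dicycle-avoiding-wall D S , Potential.no-dicycle-avoiding-two-walls D S
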